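{- Let $C_n$ be the cycle on $n\ge 3$ vertices. Then $\iota(\mathrm{Mid}(C_n))=\lfloor \frac{n+2}{3}\rfloor$.
   Context: For a graph $H$ and $S\subseteq V(H)$, let $N_H[S]$ be $S$ together with all vertices adjacent to a vertex of $S$. A set $S\subseteq V(H)$ is an isolating set of $H$ if $V(H)\setminus N_H[S]$ is an independent set of $H$; $\iota(H)$ is the minimum size of an isolating set of $H$. The middle graph $\mathrm{Mid}(G)$ has vertex set $V(G)\cup\{m_e: e\in E(G)\}$, with $v\sim m_e$ iff $v$ is an endpoint of $e$, $m_e\sim m_f$ iff distinct edges $e,f$ share an endpoint, and no edges between vertices of $V(G)$. -}

module Defs where

open import Data.Nat using (ℕ; suc; _+_; _≤_)
open import Data.Fin using (Fin; zero; suc; splitAt; fromℕ<; toℕ)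
open import Data.Fin.Subset using (Subset; _∈_; _∉_; ∣_∣)
open import Data.Nat.DivMod using (_%_; m%n<n)
open import Data.Product using (_×_; _,_; ∃; ∃-syntax; proj₁; proj₂)
open import Data.Sum using (_⊎_; inj₁; inj₂)
open import Data.Empty using (⊥)
open import Relation.Nullary using (¬_)
open import Relation.Binary.PropositionalEquality using (_≡_; _≢_)
open import Level using (0ℓ)

record Graph : Set₁ where
  field
    V   : ℕ
    Adj : Fin V → Fin V → Set
open Graph public

InClosedNbhd : (H : Graph) → Subset (V H) → Fin (V H) → Set
InClosedNbhd H S v = (v ∈ S) ⊎ (∃[ u ] (u ∈ S × Adj H u v))

IsIsolating : (H : Graph) → Subset (V H) → Set
IsIsolating H S = ∀ u v → ¬ InClosedNbhd H S u → ¬ InClosedNbhd H S v → ¬ Adj H u v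

IotaIs : Graph → ℕ → Set
IotaIs H k = (∃[ S ] (IsIsolating H S × ∣ S ∣ ≡ k))
           × (∀ S → IsIsolating H S → k ≤ ∣ S ∣)

record EdgeGraph : Set where
  field
    n    : ℕ
    m    : ℕ
    ends : Fin m → Fin n × Fin n

IsEnd : (G : EdgeGraph) → Fin (EdgeGraph.n G) → Fin (EdgeGraph.m G) → Set
IsEnd G v e = (v ≡ proj₁ (EdgeGraph.ends G e)) ⊎ (v ≡ proj₂ (EdgeGraph.ends G e))

-- Middle graph: vertices Fin (n + m); the first n are V(G), the last m are the m_e.
MidAdj : (G : EdgeGraph) → (Fin (EdgeGraph.n G) ⊎ Fin (EdgeGraph.m G))
       → (Fin (EdgeGraph.n G) ⊎ Fin (EdgeGraph.m G)) → Set
MidAdj G (inj₁ x) (inj₁ y) = ⊥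
MidAdj G (inj₁ v) (inj₂ e) = IsEnd G v e
MidAdj G (inj₂ e) (inj₁ v) = IsEnd G v e
MidAdj G (inj₂ e) (inj₂ f) = e ≢ f × ∃[ v ] (IsEnd G v e × IsEnd G v f)

Mid : EdgeGraph → Graph
Mid G = record
  { V   = EdgeGraph.n G + EdgeGraph.m G
  ; Adj = λ x y → MidAdj G (splitAt (EdgeGraph.n G) x) (splitAt (EdgeGraph.n G) y)
  }

next : ∀ {n} → Fin n → Fin n
next {suc n} i = fromℕ< (m%n<n (suc (toℕ i)) (suc n))

Cycle : ℕ → EdgeGraph
Cycle n = record { n = n ; m = n ; ends = λ i → i , next i }

-- The vertex i of the cycle and the edge vertex m_i of the edge {i, i+1} are adjacent in
-- Mid(C_n), so an isolating set S must dominate one of them, for every index i. The closed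
-- neighbourhood of a single vertex of Mid(C_n) meets such pairs for only three consecutive
-- indices, whence n ≤ 3|S|. Conversely, the edge vertices m_i with i ≡ 1 (mod 3), plus m_{n-1}
-- when n ≡ 1 (mod 3), dominate all edge vertices, and what remains are original vertices of the
-- cycle, which are pairwise non-adjacent in Mid(C_n).
module Submission where

open import Defs
open import Data.Nat using (ℕ; zero; suc; _+_; _*_; _≤_; _<_; z≤n; s≤s; s≤s⁻¹)
open import Data.Nat.DivMod using (_/_; _%_; m<n⇒m%n≡m; n%n≡0; m/n≡1+[m∸n]/n; m<n*o⇒m/o<n)
open import Data.Nat.Properties
  using (≤-trans; ≤-reflexive; +-mono-≤; +-monoʳ-≤; +-monoˡ-≤; +-suc; +-comm; suc-injective;
         m≤n⇒m<n∨m≡n; 1+n≢n; module ≤-Reasoning)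
open import Data.Fin using (Fin; zero; suc; toℕ; fromℕ; inject₁; splitAt; _↑ˡ_; _↑ʳ_)
open import Data.Fin.Properties
  using (toℕ-injective; toℕ<n; toℕ-fromℕ<; toℕ-fromℕ; toℕ-inject₁; splitAt-↑ˡ; splitAt-↑ʳ;
         splitAt⁻¹-↑ʳ)
open import Data.Fin.Subset using (Subset; inside; outside; ⊥; ⊤; ⁅_⁆; _∪_; _∈_; _⊆_; ∣_∣)
open import Data.Fin.Subset.Properties
  using (∣p∣≤∣x∷p∣; ∣⊥∣≡0; ∣⊤∣≡n; ∣⁅x⁆∣≡1; p⊆q⇒∣p∣≤∣q∣; x∈⁅x⁆; x∈p∪q⁺; _∈?_)
open import Data.Vec using ([]; _∷_; _++_; here; there)
open import Data.Product using (_×_; _,_; ∃-syntax)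
open import Data.Sum using (_⊎_; inj₁; inj₂; reduce) renaming (map to ⊎-map)
open import Function using (_∘_)
open import Relation.Nullary using (¬_)
open import Relation.Nullary.Decidable using (decidable-stable)
open import Relation.Binary.PropositionalEquality using (_≡_; refl; sym; trans; cong; cong₂; subst; subst₂)

∣p∪q∣≤∣p∣+∣q∣ : ∀ {n} (p q : Subset n) → ∣ p ∪ q ∣ ≤ ∣ p ∣ + ∣ q ∣
∣p∪q∣≤∣p∣+∣q∣ []            []           = z≤n
∣p∪q∣≤∣p∣+∣q∣ (inside  ∷ p) (x ∷ q)      =
  s≤s (≤-trans (∣p∪q∣≤∣p∣+∣q∣ p q) (+-monoʳ-≤ ∣ p ∣ (∣p∣≤∣x∷p∣ x q)))
∣p∪q∣≤∣p∣+∣q∣ (outside ∷ p) (inside ∷ q) =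
  ≤-trans (s≤s (∣p∪q∣≤∣p∣+∣q∣ p q)) (≤-reflexive (sym (+-suc ∣ p ∣ ∣ q ∣)))
∣p∪q∣≤∣p∣+∣q∣ (outside ∷ p) (outside ∷ q) = ∣p∪q∣≤∣p∣+∣q∣ p q

∣⊥++p∣≡∣p∣ : ∀ m {n} (p : Subset n) → ∣ ⊥ {m} ++ p ∣ ≡ ∣ p ∣
∣⊥++p∣≡∣p∣ zero    p = refl
∣⊥++p∣≡∣p∣ (suc m) p = ∣⊥++p∣≡∣p∣ m p

∈-++⁺ʳ : ∀ {m n} (p : Subset m) {q : Subset n} {j} → j ∈ q → m ↑ʳ j ∈ p ++ q
∈-++⁺ʳ []      j∈q = j∈q
∈-++⁺ʳ (_ ∷ p) j∈q = there (∈-++⁺ʳ p j∈q)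

⋃[_]_ : ∀ {m n} → Subset m → (Fin m → Subset n) → Subset n
⋃[ []          ] F = ⊥
⋃[ inside  ∷ p ] F = F zero ∪ ⋃[ p ] (F ∘ suc)
⋃[ outside ∷ p ] F = ⋃[ p ] (F ∘ suc)

∣⋃∣≤∣p∣*c : ∀ {m n c} (p : Subset m) (F : Fin m → Subset n) →
            (∀ x → ∣ F x ∣ ≤ c) → ∣ ⋃[ p ] F ∣ ≤ ∣ p ∣ * c
∣⋃∣≤∣p∣*c {n = n} []  F bound = ≤-reflexive (∣⊥∣≡0 n)
∣⋃∣≤∣p∣*c (inside  ∷ p) F bound =
  ≤-trans (∣p∪q∣≤∣p∣+∣q∣ (F zero) _) (+-mono-≤ (bound zero) (∣⋃∣≤∣p∣*c p (F ∘ suc) (bound ∘ suc)))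
∣⋃∣≤∣p∣*c (outside ∷ p) F bound = ∣⋃∣≤∣p∣*c p (F ∘ suc) (bound ∘ suc)

∈⋃ : ∀ {m n} {p : Subset m} {F : Fin m → Subset n} {x i} → x ∈ p → i ∈ F x → i ∈ ⋃[ p ] F
∈⋃ {p = inside ∷ p}  here       i∈Fx = x∈p∪q⁺ (inj₁ i∈Fx)
∈⋃ {p = inside ∷ p}  (there x∈p) i∈Fx = x∈p∪q⁺ (inj₂ (∈⋃ x∈p i∈Fx))
∈⋃ {p = outside ∷ p} (there x∈p) i∈Fx = ∈⋃ x∈p i∈Fx

-- Membership in the union is decidable, so a doubly negated covering is enough.
covering-bound : ∀ {m n c} (p : Subset m) (F : Fin m → Subset n) → (∀ x → ∣ F x ∣ ≤ c) →
                 (∀ i → ¬ ¬ (∃[ x ] (x ∈ p × i ∈ F x))) → n ≤ ∣ p ∣ * c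
covering-bound {n = n} {c} p F bound covered = begin
  n               ≡⟨ sym (∣⊤∣≡n n) ⟩
  ∣ ⊤ {n} ∣       ≤⟨ p⊆q⇒∣p∣≤∣q∣ ⊤⊆⋃ ⟩
  ∣ ⋃[ p ] F ∣    ≤⟨ ∣⋃∣≤∣p∣*c p F bound ⟩
  ∣ p ∣ * c       ∎
  where
  open ≤-Reasoning
  ⊤⊆⋃ : ⊤ {n} ⊆ ⋃[ p ] F
  ⊤⊆⋃ {i} _ = decidable-stable (i ∈? ⋃[ p ] F)
    (λ i∉⋃ → covered i (λ (x , x∈p , i∈Fx) → i∉⋃ (∈⋃ x∈p i∈Fx)))

≤*3⇒[+2]/3≤ : ∀ {n m} → n ≤ m * 3 → (n + 2) / 3 ≤ m
≤*3⇒[+2]/3≤ {n} {m} n≤3m = s≤s⁻¹ (m<n*o⇒m/o<n (begin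
  suc (n + 2) ≡⟨ sym (+-suc n 2) ⟩
  n + 3       ≤⟨ +-monoˡ-≤ 3 n≤3m ⟩
  m * 3 + 3   ≡⟨ +-comm (m * 3) 3 ⟩
  suc m * 3   ∎))
  where open ≤-Reasoning

prev : ∀ {k} → Fin (suc k) → Fin (suc k)
prev {k} zero    = fromℕ k
prev     (suc i) = inject₁ i

toℕ-next-< : ∀ {k} (i : Fin (suc k)) → suc (toℕ i) < suc k → toℕ (next i) ≡ suc (toℕ i)
toℕ-next-< i lt = trans (toℕ-fromℕ< _) (m<n⇒m%n≡m lt)

toℕ-next-last : ∀ {k} (i : Fin (suc k)) → toℕ i ≡ k → toℕ (next i) ≡ 0
toℕ-next-last {k} i eq =
  trans (toℕ-fromℕ< _) (trans (cong (λ t → suc t % suc k) eq) (n%n≡0 (suc k)))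

prev-next : ∀ {k} (i : Fin (suc k)) → prev (next i) ≡ i
prev-next {k} i with m≤n⇒m<n∨m≡n (toℕ<n i)
... | inj₁ lt = toℕ-injective (toℕ-prev-suc (next i) (toℕ-next-< i lt))
  where
  toℕ-prev-suc : ∀ (j : Fin (suc k)) → toℕ j ≡ suc (toℕ i) → toℕ (prev j) ≡ toℕ i
  toℕ-prev-suc (suc j) eq = trans (toℕ-inject₁ j) (suc-injective eq)
... | inj₂ eq = toℕ-injective (trans (toℕ-prev-zero (next i) (toℕ-next-last i (suc-injective eq)))
                                     (sym (suc-injective eq)))
  where
  toℕ-prev-zero : ∀ (j : Fin (suc k)) → toℕ j ≡ 0 → toℕ (prev j) ≡ k
  toℕ-prev-zero zero _ = toℕ-fromℕ k

next-injective : ∀ {k} {i j : Fin (suc k)} → next i ≡ next j → i ≡ j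
next-injective {i = i} {j} eq = trans (sym (prev-next i)) (trans (cong prev eq) (prev-next j))

next-of-successor : ∀ {k} {i j : Fin (suc k)} → suc (toℕ i) ≡ toℕ j → next i ≡ j
next-of-successor {k} {i} {j} eq =
  toℕ-injective (trans (toℕ-next-< i (subst (_< suc k) (sym eq) (toℕ<n j))) eq)

around : ∀ {k} → Fin (suc k) → Subset (suc k)
around j = ⁅ prev j ⁆ ∪ ⁅ j ⁆ ∪ ⁅ next j ⁆

∣around∣≤3 : ∀ {k} (j : Fin (suc k)) → ∣ around j ∣ ≤ 3
∣around∣≤3 j = ≤-trans (∣p∪q∣≤∣p∣+∣q∣ ⁅ prev j ⁆ _)
  (+-mono-≤ (≤-reflexive (∣⁅x⁆∣≡1 (prev j)))
            (≤-trans (∣p∪q∣≤∣p∣+∣q∣ ⁅ j ⁆ ⁅ next j ⁆)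
                     (≤-reflexive (cong₂ _+_ (∣⁅x⁆∣≡1 j) (∣⁅x⁆∣≡1 (next j))))))

∈around : ∀ {k} {i j : Fin (suc k)} → i ≡ prev j ⊎ i ≡ j ⊎ i ≡ next j → i ∈ around j
∈around (inj₁ refl)        = x∈p∪q⁺ (inj₁ (x∈⁅x⁆ _))
∈around (inj₂ (inj₁ refl)) = x∈p∪q⁺ (inj₂ (x∈p∪q⁺ (inj₁ (x∈⁅x⁆ _))))
∈around (inj₂ (inj₂ refl)) = x∈p∪q⁺ (inj₂ (x∈p∪q⁺ (inj₂ (x∈⁅x⁆ _))))

midAdj-around : ∀ {k} (s t : Fin (suc k) ⊎ Fin (suc k)) →
                MidAdj (Cycle (suc k)) s t → reduce t ∈ around (reduce s)
midAdj-around (inj₁ j) (inj₂ i) (inj₁ refl) = ∈around (inj₂ (inj₁ refl))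
midAdj-around (inj₁ _) (inj₂ i) (inj₂ refl) = ∈around (inj₁ (sym (prev-next i)))
midAdj-around (inj₂ j) (inj₁ i) (inj₁ refl) = ∈around (inj₂ (inj₁ refl))
midAdj-around (inj₂ j) (inj₁ i) (inj₂ refl) = ∈around (inj₂ (inj₂ refl))
midAdj-around (inj₂ j) (inj₂ i) (_ , _ , inj₁ refl , inj₁ refl) = ∈around (inj₂ (inj₁ refl))
midAdj-around (inj₂ _) (inj₂ i) (_ , _ , inj₁ refl , inj₂ refl) = ∈around (inj₁ (sym (prev-next i)))
midAdj-around (inj₂ j) (inj₂ i) (_ , _ , inj₂ refl , inj₁ refl) = ∈around (inj₂ (inj₂ refl))
midAdj-around (inj₂ j) (inj₂ i) (_ , _ , inj₂ eq   , inj₂ eq′)  =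
  ∈around (inj₂ (inj₁ (next-injective (trans (sym eq′) eq))))

-- The indices ≡ 1 (mod 3), together with the last index when n ≡ 1 (mod 3).
spaced : (n : ℕ) → Subset n
spaced zero                = []
spaced (suc zero)          = inside ∷ []
spaced (suc (suc zero))    = outside ∷ inside ∷ []
spaced (suc (suc (suc n))) = outside ∷ inside ∷ outside ∷ spaced n

∣spaced∣ : ∀ n → ∣ spaced n ∣ ≡ (n + 2) / 3
∣spaced∣ zero                = refl
∣spaced∣ (suc zero)          = refl
∣spaced∣ (suc (suc zero))    = refl
∣spaced∣ (suc (suc (suc n))) =
  trans (cong suc (∣spaced∣ n)) (sym (m/n≡1+[m∸n]/n {3 + (n + 2)} {3} (s≤s (s≤s (s≤s z≤n)))))

Consecutive : ∀ {n} → Fin n → Fin n → Set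
Consecutive i j = suc (toℕ i) ≡ toℕ j ⊎ suc (toℕ j) ≡ toℕ i

spaced-dominates : ∀ {n} (i : Fin n) → i ∈ spaced n ⊎ ∃[ j ] (j ∈ spaced n × Consecutive i j)
spaced-dominates {suc zero}          zero             = inj₁ here
spaced-dominates {suc (suc zero)}    zero             = inj₂ (suc zero , there here , inj₁ refl)
spaced-dominates {suc (suc zero)}    (suc zero)       = inj₁ (there here)
spaced-dominates {suc (suc (suc n))} zero             = inj₂ (suc zero , there here , inj₁ refl)
spaced-dominates {suc (suc (suc n))} (suc zero)       = inj₁ (there here)
spaced-dominates {suc (suc (suc n))} (suc (suc zero)) = inj₂ (suc zero , there here , inj₂ refl)
spaced-dominates {suc (suc (suc n))} (suc (suc (suc i))) =
  ⊎-map shift (λ (j , j∈ , c) → suc (suc (suc j)) , shift j∈ , ⊎-map (cong (3 +_)) (cong (3 +_)) c)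
        (spaced-dominates i)
  where
  shift : ∀ {x} → x ∈ spaced n → suc (suc (suc x)) ∈ spaced (3 + n)
  shift = there ∘ there ∘ there

module MidCycle (k : ℕ) where

  N : ℕ
  N = suc k

  H : Graph
  H = Mid (Cycle N)

  vertex edge : Fin N → Fin (N + N)
  vertex i = i ↑ˡ N
  edge   i = N ↑ʳ i

  position : Fin (N + N) → Fin N
  position x = reduce (splitAt N x)

  reach : Fin (N + N) → Subset N
  reach x = around (position x)

  closedNbhd⇒reached : ∀ S y {i} → position y ≡ i → InClosedNbhd H S y → ∃[ x ] (x ∈ S × i ∈ reach x)
  closedNbhd⇒reached S y refl (inj₁ y∈S)             = y , y∈S , ∈around (inj₂ (inj₁ refl))
  closedNbhd⇒reached S y refl (inj₂ (x , x∈S , adj)) = x , x∈S , midAdj-around _ _ adj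

  vertex-edge-adjacent : ∀ i → Adj H (vertex i) (edge i)
  vertex-edge-adjacent i =
    subst₂ (MidAdj (Cycle N)) (sym (splitAt-↑ˡ N i N)) (sym (splitAt-↑ʳ N N i)) (inj₁ refl)

  lower-bound : ∀ S → IsIsolating H S → N ≤ ∣ S ∣ * 3
  lower-bound S isolating = covering-bound S reach (∣around∣≤3 ∘ position) every-index-reached
    where
    every-index-reached : ∀ i → ¬ ¬ (∃[ x ] (x ∈ S × i ∈ reach x))
    every-index-reached i unreached = isolating (vertex i) (edge i)
      (unreached ∘ closedNbhd⇒reached S (vertex i) (cong reduce (splitAt-↑ˡ N i N)))
      (unreached ∘ closedNbhd⇒reached S (edge i) (cong reduce (splitAt-↑ʳ N N i)))
      (vertex-edge-adjacent i)

  consecutive-edges-adjacent : ∀ {i j} → Consecutive i j → Adj H (edge j) (edge i)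
  consecutive-edges-adjacent {i} {j} c =
    subst₂ (MidAdj (Cycle N)) (sym (splitAt-↑ʳ N N j)) (sym (splitAt-↑ʳ N N i)) (midAdj c)
    where
    midAdj : Consecutive i j → MidAdj (Cycle N) (inj₂ j) (inj₂ i)
    midAdj (inj₁ eq) = (λ { refl → 1+n≢n eq }) , j , inj₁ refl , inj₂ (sym (next-of-successor eq))
    midAdj (inj₂ eq) = (λ { refl → 1+n≢n eq }) , i , inj₂ (sym (next-of-successor eq)) , inj₁ refl

  S₀ : Subset (N + N)
  S₀ = ⊥ {N} ++ spaced N

  ∣S₀∣ : ∣ S₀ ∣ ≡ (N + 2) / 3
  ∣S₀∣ = trans (∣⊥++p∣≡∣p∣ N (spaced N)) (∣spaced∣ N)

  edges-dominated : ∀ i → InClosedNbhd H S₀ (edge i)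
  edges-dominated i with spaced-dominates i
  ... | inj₁ i∈            = inj₁ (∈-++⁺ʳ (⊥ {N}) i∈)
  ... | inj₂ (j , j∈ , c) = inj₂ (edge j , ∈-++⁺ʳ (⊥ {N}) j∈ , consecutive-edges-adjacent c)

  -- Undominated vertices are cycle vertices, and no two of those are adjacent.
  edge-dominating⇒isolating : ∀ S → (∀ i → InClosedNbhd H S (edge i)) → IsIsolating H S
  edge-dominating⇒isolating S dominated u v u∉ v∉ = no-adjacency _ _ refl refl
    where
    no-adjacency : ∀ s t → splitAt N u ≡ s → splitAt N v ≡ t → ¬ MidAdj (Cycle N) s t
    no-adjacency (inj₂ i) _        u≡ _  _ = u∉ (subst (InClosedNbhd H S) (splitAt⁻¹-↑ʳ u≡) (dominated i))
    no-adjacency (inj₁ _) (inj₂ i) _  v≡ _ = v∉ (subst (InClosedNbhd H S) (splitAt⁻¹-↑ʳ v≡) (dominated i))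
    no-adjacency (inj₁ _) (inj₁ _) _  _  ()

-- The count holds for every cycle length n ≥ 1; the hypothesis 3 ≤ n only rules out n = 0.
theorem5 : (n : ℕ) → 3 ≤ n → IotaIs (Mid (Cycle n)) ((n + 2) / 3)
theorem5 (suc k) _ =
  (S₀ , edge-dominating⇒isolating S₀ edges-dominated , ∣S₀∣) ,
  (λ S isolating → ≤*3⇒[+2]/3≤ (lower-bound S isolating))
  where open MidCycle k
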